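{- Let $T$ be a tree with at least two leaves, and suppose its vertex set is $2$-coloured with colours "odd" and "even". Let $V_{\mathrm{odd}}(T)$ be the set of vertices coloured odd and $(V_{\mathrm{int}})_{\mathrm{even}}(T)$ the set of interior vertices coloured even. Then $|V_{\mathrm{odd}}(T)|\ge|(V_{\mathrm{int}})_{\mathrm{even}}(T)|+1$.
   Context: A $2$-colouring of a graph is an assignment of one of two colours to each vertex such that adjacent vertices receive different colours. Interior vertices of a tree are the vertices that are not leaves (leaves being the degree-one vertices). -}

module Defs where

open import Data.Nat using (ℕ; _≤_; _≟_)
open import Data.Fin using (Fin)
open import Data.Bool using (Bool; true; false)
import Data.Bool as B
open import Data.List using (List; []; _∷_; _∷ʳ_; length; filter; allFin)
open import Data.List.Relation.Unary.Linked using (Linked)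
open import Data.List.Relation.Unary.Unique.Propositional using (Unique)
open import Data.Product using (Σ; ∃; _×_)
open import Relation.Binary.PropositionalEquality using (_≡_; _≢_; refl)
open import Relation.Nullary using (¬_; Dec; yes; no)
open import Relation.Nullary.Decidable using (_×-dec_; ¬?)

record Graph (n : ℕ) : Set where
  field
    adj   : Fin n → Fin n → Bool
    sym   : ∀ u v → adj u v ≡ adj v u
    irrfl : ∀ v → adj v v ≡ false

module _ {n : ℕ} (G : Graph n) where
  open Graph G

  Adj : Fin n → Fin n → Set
  Adj u v = adj u v ≡ true

  degree : Fin n → ℕ
  degree v = length (filter (λ u → adj v u B.≟ true) (allFin n))

  Leaf : Fin n → Set
  Leaf v = degree v ≡ 1

  leaf? : (v : Fin n) → Dec (Leaf v)
  leaf? v = degree v ≟ 1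

  Interior : Fin n → Set
  Interior v = ¬ Leaf v

  interior? : (v : Fin n) → Dec (Interior v)
  interior? v = ¬? (leaf? v)

  numLeaves : ℕ
  numLeaves = length (filter leaf? (allFin n))

  Connected : Set
  Connected = ∀ u v → u ≢ v → ∃ λ (xs : List (Fin n)) → Linked Adj (u ∷ xs ∷ʳ v)

  Cycle : Set
  Cycle = Σ (Fin n) λ v → Σ (List (Fin n)) λ ys →
            Unique (v ∷ ys) × 2 ≤ length ys × Linked Adj (v ∷ ys ∷ʳ v)

  Acyclic : Set
  Acyclic = ¬ Cycle

  IsTree : Set
  IsTree = Connected × Acyclic

data Colour : Set where
  odd even : Colour

_≟ᶜ_ : (a b : Colour) → Dec (a ≡ b)
odd  ≟ᶜ odd  = yes refl
odd  ≟ᶜ even = no λ ()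
even ≟ᶜ odd  = no λ ()
even ≟ᶜ even = yes refl

module _ {n : ℕ} (G : Graph n) where

  Is2Colouring : (Fin n → Colour) → Set
  Is2Colouring c = ∀ u v → Adj G u v → c u ≢ c v

  numOdd : (Fin n → Colour) → ℕ
  numOdd c = length (filter (λ v → c v ≟ᶜ odd) (allFin n))

  numIntEven : (Fin n → Colour) → ℕ
  numIntEven c = length (filter (λ v → interior? G v ×-dec (c v ≟ᶜ even)) (allFin n))

module Submission where

-- For a set S of vertices write deg_S u for the number of
-- neighbours of u inside S, and let D(S) be the sum of deg_S u over the
-- EVEN vertices u of S.  In a properly 2-coloured graph every edge has
-- exactly one even endpoint, so D(S) counts the edges of the induced
-- subgraph on S; the proof only needs the two facts below.
--
--   (1) A nonempty vertex set S of a forest contains a vertex z with at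
--       most one neighbour in S (the end of a maximal path inside S).
--   (2) Deleting a vertex x from S lowers D by at most deg_S x, because
--       the edges at x are counted either at x or at its neighbours.
--
-- Deleting such a z repeatedly gives D(S) + 1 ≤ |S| for every nonempty S
-- of a forest.  For S = all vertices of the tree T, every even interior
-- vertex contributes at least 2 to D and every even leaf contributes 1,
-- while |S| = |V_odd| + |(V_int)_even| + |(V_leaf)_even|; comparing the two
-- counts gives |(V_int)_even| + 1 ≤ |V_odd|.

open import Defs
open import Data.Nat using (ℕ; zero; suc; _≤_; _<_; _+_; z≤n; s≤s)
open import Data.Nat.Properties
open import Algebra.Properties.CommutativeMonoid.Sum +-0-commutativeMonoid
  using (sum; sum-cong-≗; sum-replicate-zero; sum-remove; ∑-distrib-+)
open import Data.Fin using (Fin; zero; suc; punchIn)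
open import Data.Fin.Properties using (any?; punchInᵢ≢i) renaming (_≟_ to _≟F_)
open import Data.Vec.Functional using (removeAt)
open import Data.Bool using (Bool; true; false; _∧_; not)
import Data.Bool as B
open import Data.Bool.Properties using (∧-zeroʳ; ∧-identityʳ)
open import Data.List using (List; []; _∷_; _∷ʳ_; _++_; [_]; length; filter; tabulate)
open import Data.List.Properties using (++-assoc; length-++-≤ʳ)
open import Data.List.Relation.Unary.Linked using (Linked; []; [-]; _∷_)
open import Data.List.Relation.Unary.AllPairs using ([]; _∷_)
open import Data.List.Relation.Unary.All using (All; []; _∷_)
open import Data.List.Relation.Unary.All.Properties using (¬Any⇒All¬; ++⁻ˡ)
open import Data.List.Relation.Unary.Any using (here; there)
open import Data.List.Relation.Unary.Unique.Propositional using (Unique)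
open import Data.List.Membership.Propositional using (_∈_; _∉_)
open import Data.List.Membership.Propositional.Properties using (∈-∃++)
open import Data.Product using (∃; _×_; _,_; proj₁; proj₂)
import Data.Product as Product
open import Data.Empty using (⊥-elim)
open import Function using (_∘_; id)
open import Relation.Binary.PropositionalEquality
  using (_≡_; _≢_; refl; sym; trans; cong; cong₂; subst; module ≡-Reasoning)
open import Relation.Nullary using (Dec; yes; no; does; contradiction)
open import Relation.Nullary.Decidable using (_×-dec_; ¬?; dec-true; dec-false)
open import Relation.Unary using (Decidable)

infixr 7 [_]·_
[_]·_ : Bool → ℕ → ℕ
[ true  ]· k = k
[ false ]· k = 0

[]·-≤ : ∀ b k → [ b ]· k ≤ k
[]·-≤ true  k = ≤-refl
[]·-≤ false k = z≤n

[]·-≤-+ : ∀ b {k l m} → k ≤ l + m → [ b ]· k ≤ [ b ]· l + [ b ]· m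
[]·-≤-+ true  k≤l+m = k≤l+m
[]·-≤-+ false _     = z≤n

[]·-zero : ∀ b → [ b ]· 0 ≡ 0
[]·-zero true  = refl
[]·-zero false = refl

[]·1-positive : ∀ b → 1 ≤ [ b ]· 1 → b ≡ true
[]·1-positive true _ = refl

decided : ∀ {A : Set} (a? : Dec A) → does a? ≡ true → A
decided (yes a) _ = a

∑-mono : ∀ {n} {f g : Fin n → ℕ} → (∀ i → f i ≤ g i) → sum f ≤ sum g
∑-mono {zero}  _   = z≤n
∑-mono {suc n} f≤g = +-mono-≤ (f≤g zero) (∑-mono (f≤g ∘ suc))

∑-zero : ∀ {n} {f : Fin n → ℕ} → (∀ i → f i ≡ 0) → sum f ≡ 0
∑-zero {n} f≡0 = trans (sum-cong-≗ f≡0) (sum-replicate-zero n)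

∑-positive : ∀ {n} (f : Fin n → ℕ) → 1 ≤ sum f → ∃ λ i → 1 ≤ f i
∑-positive {suc n} f pos with f zero in f₀
... | suc _ = zero , subst (1 ≤_) (sym f₀) (s≤s z≤n)
... | zero  = Product.map suc id (∑-positive (f ∘ suc) pos)

∑-point : ∀ {n} (f : Fin n → ℕ) x → f x ≤ sum f
∑-point {suc n} f x = ≤-trans (m≤m+n (f x) _) (≤-reflexive (sym (sum-remove {i = x} f)))

∑-change : ∀ {n} (f g : Fin n → ℕ) x → (∀ i → i ≢ x → f i ≤ g i) → sum f ≤ f x + sum g
∑-change {suc n} f g x f≤g = begin
    sum f                        ≡⟨ sum-remove {i = x} f ⟩
    f x + sum (removeAt f x)     ≤⟨ +-monoʳ-≤ (f x) (∑-mono away) ⟩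
    f x + sum (removeAt g x)     ≤⟨ +-monoʳ-≤ (f x) (m≤n+m _ (g x)) ⟩
    f x + (g x + sum (removeAt g x)) ≡⟨ cong (f x +_) (sym (sum-remove {i = x} g)) ⟩
    f x + sum g                  ∎
  where
  open ≤-Reasoning
  away : ∀ j → f (punchIn x j) ≤ g (punchIn x j)
  away j = f≤g (punchIn x j) (punchInᵢ≢i x j)

∑-drop : ∀ {n} (f g : Fin n → ℕ) x → g x ≡ 0 → (∀ i → i ≢ x → f i ≡ g i) →
         sum f ≡ f x + sum g
∑-drop {suc n} f g x gx≡0 f≡g = begin
    sum f                        ≡⟨ sum-remove {i = x} f ⟩
    f x + sum (removeAt f x)     ≡⟨ cong (f x +_) (sum-cong-≗ away) ⟩
    f x + sum (removeAt g x)     ≡⟨ cong (λ k → f x + (k + sum (removeAt g x))) gx≡0 ⟨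
    f x + (g x + sum (removeAt g x)) ≡⟨ cong (f x +_) (sym (sum-remove {i = x} g)) ⟩
    f x + sum g                  ∎
  where
  open ≡-Reasoning
  away : ∀ j → f (punchIn x j) ≡ g (punchIn x j)
  away j = f≡g (punchIn x j) (punchInᵢ≢i x j)

∑-only : ∀ {n} (f : Fin n → ℕ) x → (∀ i → i ≢ x → f i ≡ 0) → sum f ≡ f x
∑-only {n} f x f≡0 = trans (∑-drop f (λ _ → 0) x refl f≡0)
                       (trans (cong (f x +_) (∑-zero {n} (λ _ → refl))) (+-identityʳ (f x)))

count-tabulate : ∀ {n} {A : Set} {P : A → Set} (P? : Decidable P) (f : Fin n → A) →
                 length (filter P? (tabulate f)) ≡ sum (λ i → [ does (P? (f i)) ]· 1)
count-tabulate {zero}  P? f = refl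
count-tabulate {suc n} P? f with does (P? (f zero))
... | true  = cong suc (count-tabulate P? (f ∘ suc))
... | false = count-tabulate P? (f ∘ suc)

All-prefix : ∀ {A : Set} {P : A → Set} (as : List A) b bs →
             All P (as ++ b ∷ bs) → All P (as ∷ʳ b)
All-prefix as b bs ps = ++⁻ˡ (as ∷ʳ b) (subst (All _) (sym (++-assoc as [ b ] bs)) ps)

Unique-prefix : ∀ {A : Set} (as : List A) b bs → Unique (as ++ b ∷ bs) → Unique (as ∷ʳ b)
Unique-prefix []       b bs (_ ∷ _)  = [] ∷ []
Unique-prefix (a ∷ as) b bs (a∉ ∷ u) = All-prefix as b bs a∉ ∷ Unique-prefix as b bs u

Linked-prefix : ∀ {A : Set} {R : A → A → Set} (as : List A) b bs →
                Linked R (as ++ b ∷ bs) → Linked R (as ∷ʳ b)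
Linked-prefix []            b bs _       = [-]
Linked-prefix (a ∷ [])      b bs (r ∷ _) = r ∷ [-]
Linked-prefix (a ∷ a′ ∷ as) b bs (r ∷ l) = r ∷ Linked-prefix (a′ ∷ as) b bs l

Linked-∷ʳ : ∀ {A : Set} {R : A → A → Set} (as : List A) a b →
            Linked R (as ∷ʳ a) → R a b → Linked R (as ∷ʳ a ∷ʳ b)
Linked-∷ʳ []             a b _       rab = rab ∷ [-]
Linked-∷ʳ (a₀ ∷ [])      a b (r ∷ _) rab = r ∷ rab ∷ [-]
Linked-∷ʳ (a₀ ∷ a₁ ∷ as) a b (r ∷ l) rab = r ∷ Linked-∷ʳ (a₁ ∷ as) a b l rab

module InducedDegree {n : ℕ} (G : Graph n) where
  open Graph G using (adj; irrfl) renaming (sym to adj-sym)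
  open import Data.List.Membership.DecPropositional (_≟F_ {n}) using (_∈?_)

  VertexSet : Set
  VertexSet = Fin n → Bool

  degIn : VertexSet → Fin n → ℕ
  degIn S u = sum (λ v → [ S v ]· [ adj u v ]· 1)

  size : VertexSet → ℕ
  size S = sum (λ v → [ S v ]· 1)

  allVertices : VertexSet
  allVertices _ = true

  _∖_ : VertexSet → Fin n → VertexSet
  (S ∖ x) u = S u ∧ not (does (u ≟F x))

  ∖-self : ∀ S x → (S ∖ x) x ≡ false
  ∖-self S x rewrite dec-true (x ≟F x) refl = ∧-zeroʳ (S x)

  ∖-other : ∀ S x u → u ≢ x → (S ∖ x) u ≡ S u
  ∖-other S x u u≢x rewrite dec-false (u ≟F x) u≢x = ∧-identityʳ (S u)

  size-∖ : ∀ S x → S x ≡ true → size S ≡ suc (size (S ∖ x))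
  size-∖ S x Sx = trans (∑-drop _ _ x (cong ([_]· 1) (∖-self S x)) same)
                        (cong (λ b → [ b ]· 1 + size (S ∖ x)) Sx)
    where
    same : ∀ v → v ≢ x → [ S v ]· 1 ≡ [ (S ∖ x) v ]· 1
    same v v≢x = cong ([_]· 1) (sym (∖-other S x v v≢x))

  size-zero : ∀ S v → size S ≡ 0 → S v ≡ false
  size-zero S v |S|≡0 with S v in Sv
  ... | false = refl
  ... | true  = contradiction (subst (1 ≤_) |S|≡0 (subst (λ b → [ b ]· 1 ≤ size S) Sv
                  (∑-point (λ w → [ S w ]· 1) v))) (λ ())

  size-suc : ∀ S {k} → size S ≡ suc k → ∃ λ x → S x ≡ true
  size-suc S |S| with ∑-positive (λ v → [ S v ]· 1) (subst (1 ≤_) (sym |S|) (s≤s z≤n))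
  ... | x , pos = x , []·1-positive (S x) pos

  degIn-∖ : ∀ S x u → degIn S u ≤ degIn (S ∖ x) u + [ adj u x ]· 1
  degIn-∖ S x u = begin
      degIn S u                                  ≤⟨ ∑-change _ _ x away ⟩
      [ S x ]· [ adj u x ]· 1 + degIn (S ∖ x) u  ≤⟨ +-monoˡ-≤ _ ([]·-≤ (S x) _) ⟩
      [ adj u x ]· 1 + degIn (S ∖ x) u           ≡⟨ +-comm _ (degIn (S ∖ x) u) ⟩
      degIn (S ∖ x) u + [ adj u x ]· 1           ∎
    where
    open ≤-Reasoning
    away : ∀ v → v ≢ x → [ S v ]· [ adj u v ]· 1 ≤ [ (S ∖ x) v ]· [ adj u v ]· 1
    away v v≢x = ≤-reflexive (cong (λ b → [ b ]· [ adj u v ]· 1) (sym (∖-other S x v v≢x)))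

  degIn-empty : ∀ S u → size S ≡ 0 → degIn S u ≡ 0
  degIn-empty S u |S|≡0 =
    ∑-zero (λ v → cong (λ b → [ b ]· [ adj u v ]· 1) (size-zero S v |S|≡0))

  degIn-≤1 : ∀ S x h → (∀ v → S v ≡ true → adj x v ≡ true → v ≡ h) → degIn S x ≤ 1
  degIn-≤1 S x h onlyH =
    ≤-trans (≤-reflexive (∑-only _ h vanish)) (≤-trans ([]·-≤ (S h) _) ([]·-≤ (adj x h) 1))
    where
    vanish : ∀ v → v ≢ h → [ S v ]· [ adj x v ]· 1 ≡ 0
    vanish v v≢h with S v in Sv | adj x v in xv
    ... | false | _     = refl
    ... | true  | false = refl
    ... | true  | true  = contradiction (onlyH v Sv xv) v≢h

  closeCycle : ∀ x h rest y → Unique (x ∷ h ∷ rest) → Linked (Adj G) (x ∷ h ∷ rest) →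
               y ∈ rest → Adj G y x → Cycle G
  closeCycle x h rest y unique linked y∈rest yx with ∈-∃++ y∈rest
  ... | pre , post , refl =
    x , (h ∷ pre) ∷ʳ y , Unique-prefix (x ∷ h ∷ pre) y post unique ,
    s≤s (length-++-≤ʳ [ y ] {pre}) ,
    Linked-∷ʳ (x ∷ h ∷ pre) y x (Linked-prefix (x ∷ h ∷ pre) y post linked) yx

  -- In an acyclic graph, the end x of a path all of whose S-neighbours
  -- lie on the path has at most one S-neighbour: any neighbour other than
  -- the next vertex h of the path would close a cycle.
  pathEnd-degIn : Acyclic G → ∀ S x rest → Unique (x ∷ rest) → Linked (Adj G) (x ∷ rest) →
                  (∀ v → S v ≡ true → adj x v ≡ true → v ∈ x ∷ rest) → degIn S x ≤ 1
  pathEnd-degIn acyclic S x [] _ _ onPath = degIn-≤1 S x x onlyX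
    where
    onlyX : ∀ v → S v ≡ true → adj x v ≡ true → v ≡ x
    onlyX v Sv xv with onPath v Sv xv
    ... | here v≡x = v≡x
  pathEnd-degIn acyclic S x (h ∷ rest) unique linked onPath = degIn-≤1 S x h onlyH
    where
    onlyH : ∀ v → S v ≡ true → adj x v ≡ true → v ≡ h
    onlyH v Sv xv with onPath v Sv xv
    ... | here refl            = contradiction (trans (sym xv) (irrfl x)) (λ ())
    ... | there (here v≡h)     = v≡h
    ... | there (there v∈rest) =
      ⊥-elim (acyclic (closeCycle x h rest v unique linked v∈rest (trans (adj-sym v x) xv)))

  -- Grow a path x ∷ rest (newest vertex first) inside S as long as its end
  -- has an S-neighbour off the path.  Every S-vertex off the path lies in
  -- the set R of size k, so at most k further extensions are possible.
  extendPath : Acyclic G → ∀ S k (R : VertexSet) → size R ≡ k →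
               ∀ x rest → Unique (x ∷ rest) → Linked (Adj G) (x ∷ rest) → S x ≡ true →
               (∀ v → S v ≡ true → v ∉ x ∷ rest → R v ≡ true) →
               ∃ λ z → S z ≡ true × degIn S z ≤ 1
  extendPath acyclic S k R |R| x rest unique linked Sx inR
    with any? (λ w → ((S w B.≟ true) ×-dec (adj x w B.≟ true)) ×-dec ¬? (w ∈? (x ∷ rest)))
  ... | no noExit = x , Sx , pathEnd-degIn acyclic S x rest unique linked onPath
    where
    onPath : ∀ v → S v ≡ true → adj x v ≡ true → v ∈ x ∷ rest
    onPath v Sv xv with v ∈? (x ∷ rest)
    ... | yes v∈ = v∈
    ... | no  v∉ = ⊥-elim (noExit (v , (Sv , xv) , v∉))
  ... | yes (w , (Sw , xw) , w∉) with k
  ...   | zero  = contradiction (trans (sym (inR w Sw w∉)) (size-zero R w |R|)) (λ ())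
  ...   | suc k = extendPath acyclic S k (R ∖ w) (suc-injective (trans (sym (size-∖ R w Rw)) |R|))
                    w (x ∷ rest) (¬Any⇒All¬ _ w∉ ∷ unique) (trans (adj-sym w x) xw ∷ linked) Sw inR′
    where
    Rw : R w ≡ true
    Rw = inR w Sw w∉
    inR′ : ∀ v → S v ≡ true → v ∉ w ∷ x ∷ rest → (R ∖ w) v ≡ true
    inR′ v Sv v∉ = trans (∖-other R w v (v∉ ∘ here)) (inR v Sv (v∉ ∘ there))

  lowDegreeVertex : Acyclic G → ∀ S x → S x ≡ true → ∃ λ z → S z ≡ true × degIn S z ≤ 1
  lowDegreeVertex acyclic S x Sx =
    extendPath acyclic S _ (S ∖ x) refl x [] ([] ∷ []) [-] Sx offPath
    where
    offPath : ∀ v → S v ≡ true → v ∉ x ∷ [] → (S ∖ x) v ≡ true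
    offPath v Sv v∉ = trans (∖-other S x v (v∉ ∘ here)) Sv

module EvenDegreeSum {n : ℕ} (G : Graph n) (c : Fin n → Colour) (proper : Is2Colouring G c) where
  open Graph G using (adj; irrfl) renaming (sym to adj-sym)
  open InducedDegree G

  isEven : Fin n → Bool
  isEven u = does (c u ≟ᶜ even)

  evenDegSum : VertexSet → ℕ
  evenDegSum S = sum (λ u → [ isEven u ]· [ S u ]· degIn S u)

  evenNeighbour : VertexSet → Fin n → Fin n → ℕ
  evenNeighbour S x u = [ isEven u ]· [ S u ]· [ adj u x ]· 1

  isEven⇒even : ∀ u → isEven u ≡ true → c u ≡ even
  isEven⇒even u eu with c u
  ... | even = refl

  noEvenEdge : ∀ u x → isEven u ≡ true → isEven x ≡ true → adj u x ≡ false
  noEvenEdge u x eu ex with adj u x in ux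
  ... | false = refl
  ... | true  = contradiction (trans (isEven⇒even u eu) (sym (isEven⇒even x ex))) (proper u x ux)

  -- The edges at x are counted either at x (if x is even) or at its even
  -- neighbours (if x is odd), never at both: together at most deg_S x.
  evenNeighbours-≤ : ∀ S x → sum (evenNeighbour S x) + [ isEven x ]· [ S x ]· degIn S x ≤ degIn S x
  evenNeighbours-≤ S x with isEven x in ex
  ... | true  = ≤-trans (≤-reflexive (cong (_+ _) (∑-zero noneEven))) ([]·-≤ (S x) _)
    where
    noneEven : ∀ u → evenNeighbour S x u ≡ 0
    noneEven u with isEven u in eu
    ... | false = refl
    ... | true  rewrite noEvenEdge u x eu ex = []·-zero (S u)
  ... | false = ≤-trans (≤-reflexive (+-identityʳ _)) (∑-mono atOddX)
    where
    atOddX : ∀ u → evenNeighbour S x u ≤ [ S u ]· [ adj x u ]· 1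
    atOddX u rewrite adj-sym u x = []·-≤ (isEven u) _

  evenDegSum-∖ : ∀ S x → evenDegSum S ≤ evenDegSum (S ∖ x) + degIn S x
  evenDegSum-∖ S x = begin
      evenDegSum S
        ≤⟨ ∑-change (term S) (λ u → term (S ∖ x) u + evenNeighbour S x u) x away ⟩
      term S x + sum (λ u → term (S ∖ x) u + evenNeighbour S x u)
        ≡⟨ cong (term S x +_) (∑-distrib-+ (term (S ∖ x)) (evenNeighbour S x)) ⟩
      term S x + (evenDegSum (S ∖ x) + sum (evenNeighbour S x))
        ≡⟨ solve ⟩
      evenDegSum (S ∖ x) + (sum (evenNeighbour S x) + term S x)
        ≤⟨ +-monoʳ-≤ (evenDegSum (S ∖ x)) (evenNeighbours-≤ S x) ⟩
      evenDegSum (S ∖ x) + degIn S x ∎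
    where
    open ≤-Reasoning
    term : VertexSet → Fin n → ℕ
    term R u = [ isEven u ]· [ R u ]· degIn R u
    away : ∀ u → u ≢ x → term S u ≤ term (S ∖ x) u + evenNeighbour S x u
    away u u≢x rewrite ∖-other S x u u≢x =
      []·-≤-+ (isEven u) ([]·-≤-+ (S u) (degIn-∖ S x u))
    solve : term S x + (evenDegSum (S ∖ x) + sum (evenNeighbour S x)) ≡
            evenDegSum (S ∖ x) + (sum (evenNeighbour S x) + term S x)
    solve = trans (+-comm (term S x) _) (+-assoc (evenDegSum (S ∖ x)) _ _)

  evenDegSum-empty : ∀ S → size S ≡ 0 → evenDegSum S ≡ 0
  evenDegSum-empty S |S|≡0 = ∑-zero vanish
    where
    vanish : ∀ u → [ isEven u ]· [ S u ]· degIn S u ≡ 0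
    vanish u = trans (cong (λ b → [ isEven u ]· [ b ]· degIn S u) (size-zero S u |S|≡0))
                     ([]·-zero (isEven u))

  -- D(S) < |S| for every nonempty S of a forest, by repeatedly deleting a
  -- vertex with at most one neighbour in the remaining set.
  evenDegSum-< : Acyclic G → ∀ k S → size S ≡ suc k → evenDegSum S < size S
  evenDegSum-< acyclic k S |S| with size-suc S |S|
  ... | x , Sx with lowDegreeVertex acyclic S x Sx
  ... | z , Sz , deg≤1 rewrite size-∖ S z Sz =
    s≤s (≤-trans (evenDegSum-∖ S z) (remainder k (suc-injective |S|)))
    where
    remainder : ∀ k → size (S ∖ z) ≡ k → evenDegSum (S ∖ z) + degIn S z ≤ size (S ∖ z)
    remainder zero    |S∖z|≡0 = ≤-reflexive
      (trans (cong₂ _+_ (evenDegSum-empty (S ∖ z) |S∖z|≡0) isolated) (sym |S∖z|≡0))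
      where
      isolated : degIn S z ≡ 0
      isolated = n≤0⇒n≡0 (≤-trans (degIn-∖ S z z)
                   (≤-reflexive (cong₂ _+_ (degIn-empty (S ∖ z) z |S∖z|≡0) (cong ([_]· 1) (irrfl z)))))
    remainder (suc k) |S∖z| = begin
      evenDegSum (S ∖ z) + degIn S z ≤⟨ +-monoʳ-≤ (evenDegSum (S ∖ z)) deg≤1 ⟩
      evenDegSum (S ∖ z) + 1         ≡⟨ +-comm (evenDegSum (S ∖ z)) 1 ⟩
      suc (evenDegSum (S ∖ z))       ≤⟨ evenDegSum-< acyclic k (S ∖ z) |S∖z| ⟩
      size (S ∖ z)                   ∎
      where open ≤-Reasoning

module TreeDegrees {n : ℕ} (T : Graph n) where
  open Graph T using (adj)

  degree-sum : ∀ v → degree T v ≡ sum (λ w → [ adj v w ]· 1)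
  degree-sum v = trans (count-tabulate (λ w → adj v w B.≟ true) id) (sum-cong-≗ (λ w → isTrue (adj v w)))
    where
    isTrue : ∀ b → [ does (b B.≟ true) ]· 1 ≡ [ b ]· 1
    isTrue true  = refl
    isTrue false = refl

  degree-positive : ∀ v w → Adj T v w → 1 ≤ degree T v
  degree-positive v w vw = subst (1 ≤_) (sym (degree-sum v))
    (subst (λ b → [ b ]· 1 ≤ sum (λ u → [ adj v u ]· 1)) vw (∑-point _ w))

  leaf-exists : 1 ≤ numLeaves T → ∃ (Leaf T)
  leaf-exists pos with ∑-positive _ (subst (1 ≤_) (count-tabulate (leaf? T) id) pos)
  ... | v , isLeaf = v , decided (leaf? T v) ([]·1-positive _ isLeaf)

  neighbour : Connected T → ∀ u v → u ≢ v → ∃ (Adj T u)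
  neighbour connected u v u≢v with connected u v u≢v
  ... | []     , (uv ∷ _) = v , uv
  ... | w ∷ ws , (uw ∷ _) = w , uw

  interior-degree : Connected T → ∀ ℓ → Leaf T ℓ → ∀ v → Interior T v → 2 ≤ degree T v
  interior-degree connected ℓ leaf v interior =
    ≤∧≢⇒< (degree-positive v w vw) (interior ∘ sym)
    where
    v≢ℓ : v ≢ ℓ
    v≢ℓ refl = interior leaf
    w  = proj₁ (neighbour connected v ℓ v≢ℓ)
    vw = proj₂ (neighbour connected v ℓ v≢ℓ)

vertexClass : ∀ l col → [ does (col ≟ᶜ odd) ]· 1 + [ not l ∧ does (col ≟ᶜ even) ]· 1
                        + [ l ∧ does (col ≟ᶜ even) ]· 1 ≡ 1
vertexClass false odd  = refl
vertexClass false even = refl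
vertexClass true  odd  = refl
vertexClass true  even = refl

-- An even vertex of degree d contributes d to D(S); this is at least 2 if
-- it is interior and at least 1 if it is a leaf.
evenWeight : ∀ l col d → (l ≡ false → 2 ≤ d) → (l ≡ true → 1 ≤ d) →
             [ not l ∧ does (col ≟ᶜ even) ]· 1 + [ not l ∧ does (col ≟ᶜ even) ]· 1
               + [ l ∧ does (col ≟ᶜ even) ]· 1 ≤ [ does (col ≟ᶜ even) ]· d
evenWeight false odd  d interior leaf = z≤n
evenWeight true  odd  d interior leaf = z≤n
evenWeight false even d interior leaf = interior refl
evenWeight true  even d interior leaf = leaf refl

module ColouredTree {n : ℕ} (T : Graph n) (c : Fin n → Colour) (proper : Is2Colouring T c) where
  open InducedDegree T
  open EvenDegreeSum T c proper
  open TreeDegrees T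

  isLeaf : Fin n → Bool
  isLeaf v = does (leaf? T v)

  odd1 intEven1 leafEven1 : Fin n → ℕ
  odd1      v = [ does (c v ≟ᶜ odd) ]· 1
  intEven1  v = [ not (isLeaf v) ∧ isEven v ]· 1
  leafEven1 v = [ isLeaf v ∧ isEven v ]· 1

  numLeafEven : ℕ
  numLeafEven = sum leafEven1

  numOdd-sum : numOdd T c ≡ sum odd1
  numOdd-sum = count-tabulate (λ v → c v ≟ᶜ odd) id

  numIntEven-sum : numIntEven T c ≡ sum intEven1
  numIntEven-sum = count-tabulate (λ v → interior? T v ×-dec (c v ≟ᶜ even)) id

  vertexCount : size allVertices ≡ numOdd T c + numIntEven T c + numLeafEven
  vertexCount = begin
    size allVertices                               ≡⟨ sum-cong-≗ (λ v → sym (vertexClass (isLeaf v) (c v))) ⟩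
    sum (λ v → odd1 v + intEven1 v + leafEven1 v)  ≡⟨ ∑-distrib-+ (λ v → odd1 v + intEven1 v) leafEven1 ⟩
    sum (λ v → odd1 v + intEven1 v) + numLeafEven  ≡⟨ cong (_+ numLeafEven) (∑-distrib-+ odd1 intEven1) ⟩
    sum odd1 + sum intEven1 + numLeafEven          ≡⟨ cong₂ (λ o i → o + i + numLeafEven) numOdd-sum numIntEven-sum ⟨
    numOdd T c + numIntEven T c + numLeafEven      ∎
    where open ≡-Reasoning

  -- In the tree, D(V) ≥ 2 |(V_int)_even| + |(V_leaf)_even|: interior
  -- vertices have degree at least 2 and leaves degree 1.
  evenDegSum-lower : Connected T → ∃ (Leaf T) →
                     numIntEven T c + numIntEven T c + numLeafEven ≤ evenDegSum allVertices
  evenDegSum-lower connected (ℓ , ℓ-leaf) = begin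
    numIntEven T c + numIntEven T c + numLeafEven      ≡⟨ cong (λ i → i + i + numLeafEven) numIntEven-sum ⟩
    sum intEven1 + sum intEven1 + numLeafEven          ≡⟨ cong (_+ numLeafEven) (∑-distrib-+ intEven1 intEven1) ⟨
    sum (λ v → intEven1 v + intEven1 v) + numLeafEven  ≡⟨ ∑-distrib-+ (λ v → intEven1 v + intEven1 v) leafEven1 ⟨
    sum (λ v → intEven1 v + intEven1 v + leafEven1 v)  ≤⟨ ∑-mono evenVertex ⟩
    evenDegSum allVertices                             ∎
    where
    open ≤-Reasoning
    evenVertex : ∀ v → intEven1 v + intEven1 v + leafEven1 v ≤ [ isEven v ]· degIn allVertices v
    evenVertex v = evenWeight (isLeaf v) (c v) (degIn allVertices v) interiorCase leafCase
      where
      interiorCase : isLeaf v ≡ false → 2 ≤ degIn allVertices v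
      interiorCase notLeaf = subst (2 ≤_) (degree-sum v) (interior-degree connected ℓ ℓ-leaf v
        (λ leaf → contradiction (trans (sym (dec-true (leaf? T v) leaf)) notLeaf) (λ ())))
      leafCase : isLeaf v ≡ true → 1 ≤ degIn allVertices v
      leafCase yesLeaf = subst (1 ≤_) (degree-sum v) (≤-reflexive (sym (decided (leaf? T v) yesLeaf)))

cancel-counts : ∀ i l o → suc (i + i + l) ≤ o + i + l → i + 1 ≤ o
cancel-counts i l o le =
  subst (_≤ o) (+-comm 1 i) (+-cancelʳ-≤ i (suc i) o (+-cancelʳ-≤ l (suc i + i) (o + i) le))

-- The theorem: compare D(V) with |V| for the set V of all vertices.
lemma5p1 : (n : ℕ) (T : Graph n) → IsTree T → 2 ≤ numLeaves T →
           (c : Fin n → Colour) → Is2Colouring T c →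
           numIntEven T c + 1 ≤ numOdd T c
lemma5p1 n T (connected , acyclic) twoLeaves c proper =
  cancel-counts (numIntEven T c) numLeafEven (numOdd T c) (begin
    suc (numIntEven T c + numIntEven T c + numLeafEven)
      ≤⟨ s≤s (evenDegSum-lower connected someLeaf) ⟩
    suc (evenDegSum allVertices)
      ≤⟨ evenDegSum-< acyclic _ allVertices (size-∖ allVertices (proj₁ someLeaf) refl) ⟩
    size allVertices
      ≡⟨ vertexCount ⟩
    numOdd T c + numIntEven T c + numLeafEven ∎)
  where
  open ≤-Reasoning
  open InducedDegree T
  open EvenDegreeSum T c proper
  open ColouredTree T c proper

  someLeaf : ∃ (Leaf T)
  someLeaf = TreeDegrees.leaf-exists T (≤-trans (s≤s z≤n) twoLeaves)
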